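{- Let $R$ be a dedekind type domain, let $\mathit{M}(R)$ be the monoid generated by the maximal ideals of $R$, let $r\ge2$, $k\ge2$, and let $\mathcal{I}_1,\dots,\mathcal{I}_r\in\mathit{M}(R)$ be pairwise comaximal. Let $M(r,k)(R)=\{A=[a_{ij}]_{r\times k}\mid \sum_{j=1}^k\prod_{i=1}^r a_{ij}=1\}$. Then the map $\lambda:M(r,k)(R)\to\mathbb{PF}^{k-1}_{\mathcal{I}_1}\times\cdots\times\mathbb{PF}^{k-1}_{\mathcal{I}_r}$, $\lambda(A)=([a_{11}:\dots:a_{1k}],\dots,[a_{r1}:\dots:a_{rk}])$, is surjective.
   Context: Dedekind type domain: a commutative ring $R$ with unity which is a field, or in which every maximal ideal $\mathcal{M}$ satisfies $\mathcal{M}^i\neq\mathcal{M}^{i+1}$ ($i\ge0$), $\bigcap_{i\ge0}\mathcal{M}^i=(0)$, $\dim_{R/\mathcal{M}}\mathcal{M}^i/\mathcal{M}^{i+1}=1$ ($i\ge0$), and every nonzero element lies in only finitely many maximal ideals. $\mathit{M}(R)$ is the set of finite products of maximal ideals ($R$ the empty product). For an ideal $\mathcal{I}$, $\mathbb{PF}^{n}_{\mathcal{I}}$ is the set of unital tuples $(a_0,\dots,a_n)$ (generating $R$) modulo $(a_i)\sim(b_i)\iff a_ib_j-a_jb_i\in\mathcal{I}$ for all $i<j$; $[a_0:\dots:a_n]$ denotes the class. -}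

module Defs where

open import Level using (Level; _⊔_) renaming (suc to lsuc)
open import Data.Nat using (ℕ; zero; suc)
open import Data.Fin using (Fin; _<_) renaming (zero to fzero; suc to fsuc)
open import Data.Product using (Σ; ∃; _×_; _,_)
open import Data.Sum using (_⊎_)
open import Data.Unit.Polymorphic using (⊤)
open import Relation.Nullary using (¬_)
open import Algebra.Bundles using (CommutativeRing)

module _ {c ℓ : Level} (R : CommutativeRing c ℓ) where
  open CommutativeRing R using (Carrier; _≈_; _+_; _*_; _-_; 0#; 1#)

  Subset : Set (lsuc (c ⊔ ℓ))
  Subset = Carrier → Set (c ⊔ ℓ)

  ΣF : (n : ℕ) → (Fin n → Carrier) → Carrier
  ΣF zero    f = 0#
  ΣF (suc n) f = f fzero + ΣF n (λ i → f (fsuc i))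

  ΠF : (n : ℕ) → (Fin n → Carrier) → Carrier
  ΠF zero    f = 1#
  ΠF (suc n) f = f fzero * ΠF n (λ i → f (fsuc i))

  _⊆_ : Subset → Subset → Set (c ⊔ ℓ)
  I ⊆ J = ∀ x → I x → J x

  _≐_ : Subset → Subset → Set (c ⊔ ℓ)
  I ≐ J = (I ⊆ J) × (J ⊆ I)

  record IsIdeal (I : Subset) : Set (c ⊔ ℓ) where
    field
      resp  : ∀ {x y} → x ≈ y → I x → I y
      zero∈ : I 0#
      +∈    : ∀ {x y} → I x → I y → I (x + y)
      *∈    : ∀ a {x} → I x → I (a * x)

  UnitIdeal : Subset
  UnitIdeal _ = ⊤

  _·_ : Subset → Subset → Subset
  (I · J) x = ∃ λ (n : ℕ) → Σ (Fin n → Carrier) λ a → Σ (Fin n → Carrier) λ b →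
                ((∀ t → I (a t)) × (∀ t → J (b t))) × (x ≈ ΣF n (λ t → a t * b t))

  _^_ : Subset → ℕ → Subset
  M ^ zero  = UnitIdeal
  M ^ suc i = (M ^ i) · M

  ΠIdeal : (n : ℕ) → (Fin n → Subset) → Subset
  ΠIdeal zero    P = UnitIdeal
  ΠIdeal (suc n) P = P fzero · ΠIdeal n (λ i → P (fsuc i))

  record IsMaximal (M : Subset) : Set (lsuc (c ⊔ ℓ)) where
    field
      ideal   : IsIdeal M
      proper  : ¬ M 1#
      maximal : ∀ (J : Subset) → IsIdeal J → M ⊆ J → (J ⊆ M) ⊎ (∀ x → J x)

  IsField : Set (c ⊔ ℓ)
  IsField = (¬ (1# ≈ 0#)) × (∀ x → ¬ (x ≈ 0#) → ∃ λ y → x * y ≈ 1#)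

  -- dim_{R/M} M^i / M^{i+1} = 1 : a single class spans and is nonzero
  DimOne : Subset → ℕ → Set (c ⊔ ℓ)
  DimOne M i = ∃ λ x → (M ^ i) x × (¬ (M ^ suc i) x) ×
                 (∀ y → (M ^ i) y → ∃ λ a → (M ^ suc i) (y - a * x))

  record DedekindConditions : Set (lsuc (c ⊔ ℓ)) where
    field
      powers-distinct : ∀ M → IsMaximal M → ∀ i → ¬ ((M ^ i) ≐ (M ^ suc i))
      powers-meet     : ∀ M → IsMaximal M → ∀ x → (∀ i → (M ^ i) x) → x ≈ 0#
      dim-one         : ∀ M → IsMaximal M → ∀ i → DimOne M i
      finite-character : ∀ x → ¬ (x ≈ 0#) →
                         ∃ λ (n : ℕ) → Σ (Fin n → Subset) λ Q →
                           ∀ M → IsMaximal M → M x → ∃ λ j → M ≐ Q j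

  IsDedekindType : Set (lsuc (c ⊔ ℓ))
  IsDedekindType = IsField ⊎ DedekindConditions

  InMonoidM : Subset → Set (lsuc (c ⊔ ℓ))
  InMonoidM I = ∃ λ (n : ℕ) → Σ (Fin n → Subset) λ P →
                  (∀ t → IsMaximal (P t)) × (I ≐ ΠIdeal n P)

  Comaximal : Subset → Subset → Set (c ⊔ ℓ)
  Comaximal I J = ∃ λ x → ∃ λ y → I x × J y × (x + y ≈ 1#)

  Unital : (k : ℕ) → (Fin k → Carrier) → Set (c ⊔ ℓ)
  Unital k a = Σ (Fin k → Carrier) λ b → ΣF k (λ j → b j * a j) ≈ 1#

  PFEquiv : (I : Subset) (k : ℕ) → (Fin k → Carrier) → (Fin k → Carrier) → Set (c ⊔ ℓ)
  PFEquiv I k a b = ∀ (i j : Fin k) → i < j → I (a i * b j - a j * b i)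

  InMrk : (r k : ℕ) → (Fin r → Fin k → Carrier) → Set ℓ
  InMrk r k A = ΣF k (λ j → ΠF r (λ i → A i j)) ≈ 1#

-- Each I i is a finite product of maximal ideals, so R / I i has stable range one: if
-- a x + b y ≡ 1 modulo I i, then a + τ b is invertible modulo I i for some τ. This is the only
-- property of R that is used.
--
-- The rows are chosen one at a time, keeping the entrywise product P of the rows chosen so far
-- unimodular, say γ ∙ P = 1. A row a = μ v + (1 − μ S) 𝟙 with S = γ ∙ (v ⊛ P) keeps
-- γ ∙ (a ⊛ P) = 1, and it is ≡ μ v modulo I as soon as μ S ≡ 1. Stable range one, applied to a
-- perturbation of γ that preserves γ ∙ P = 1, makes S invertible modulo I; multiplying μ by a
-- Chinese-remainder element e ≡ 1 modulo I that lies in all other ideals makes the row ≡ 1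
-- modulo the ideals still to be treated. The first row must make the sum exactly 1: once the
-- second row a₁ is perturbed (by multiples of an element of I₁) so that W (v₀ ∙ (a₁ ⊛ P)) ≡ 1
-- modulo I₀, the row a₀ = W v₀ + (1 − W (v₀ ∙ (a₁ ⊛ P))) γ does this and is ≡ W v₀ modulo I₀.

module Submission where

open import Defs
open import Level using (Level; 0ℓ; _⊔_)
open import Function using (_∘_; Injective)
open import Algebra.Bundles using (CommutativeRing; RawRing)
open import Algebra.Solver.Ring.AlmostCommutativeRing
  using (fromCommutativeRing; _-Raw-AlmostCommutative⟶_)
open import Data.Nat as ℕ using (ℕ; zero; suc; _≤_; s≤s)
open import Data.Fin using (Fin; splitAt) renaming (zero to fzero; suc to fsuc)
open import Data.Fin.Properties using (suc-injective; 0≢1+n; _≟_)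
open import Data.Vec.Functional using (_++_; _∷_)
open import Data.Vec.Functional.Relation.Unary.All.Properties using (++⁺)
open import Data.Product using (Σ; _×_; _,_; proj₁; proj₂; swap)
open import Data.Product.Properties using (≡-dec)
open import Data.Sum using (_⊎_; inj₁; inj₂)
open import Data.Sum.Properties using ([,]-map)
open import Data.Maybe using (Maybe; just; nothing)
open import Data.Unit.Polymorphic using (tt)
open import Data.Empty using (⊥-elim)
open import Relation.Nullary using (yes; no)
open import Relation.Binary.PropositionalEquality as ≡ using (_≡_; _≢_)

-- Algebra.Solver.Ring with integer coefficients, so that identities involving subtraction
-- can be proved in an arbitrary commutative ring.
module IntegerCoefficientRingSolver {c ℓ} (R : CommutativeRing c ℓ) where
  open CommutativeRing R hiding (zero)
  open import Algebra.Properties.Semiring.Mult.TCOptimised semiring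
    using (×-homo-+; ×1-homo-*) renaming (_×_ to _×ᵣ_)
  open import Algebra.Properties.Ring ring using (x[y-z]≈xy-xz; [y-z]x≈yx-zx)
  open import Algebra.Properties.AbelianGroup +-abelianGroup
    using (⁻¹-∙-comm; ⁻¹-anti-homo‿-; ε⁻¹≈ε)
  open import Algebra.Properties.CommutativeSemigroup +-commutativeSemigroup using (interchange)
  open import Relation.Binary.Reasoning.Setoid setoid

  -- A pair (m , n) stands for the integer m − n; _⊖_ keeps one component
  -- zero, so that _≡_ on pairs is equality of integers.
  _⊖_ : ℕ → ℕ → ℕ × ℕ
  suc m ⊖ suc n = m ⊖ n
  m     ⊖ n     = m , n

  ℤ-rawRing : RawRing 0ℓ 0ℓ
  ℤ-rawRing = record
    { Carrier = ℕ × ℕ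
    ; _≈_     = _≡_
    ; _+_     = λ (m , n) (m′ , n′) → (m ℕ.+ m′) ⊖ (n ℕ.+ n′)
    ; _*_     = λ (m , n) (m′ , n′) → (m ℕ.* m′ ℕ.+ n ℕ.* n′) ⊖ (m ℕ.* n′ ℕ.+ n ℕ.* m′)
    ; -_      = swap
    ; 0#      = 0 , 0
    ; 1#      = 1 , 0
    }

  -- The first clause makes the constants 0 and 1 evaluate to 0# and 1#.
  ⟦_⟧ℤ : ℕ × ℕ → Carrier
  ⟦ m , zero ⟧ℤ = m ×ᵣ 1#
  ⟦ m , n    ⟧ℤ = m ×ᵣ 1# - n ×ᵣ 1#

  private
    ⟦⟧ℤ-correct : ∀ m n → ⟦ m , n ⟧ℤ ≈ m ×ᵣ 1# - n ×ᵣ 1#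
    ⟦⟧ℤ-correct m zero    = sym (trans (+-congˡ ε⁻¹≈ε) (+-identityʳ _))
    ⟦⟧ℤ-correct m (suc n) = refl

    +-‿-interchange : ∀ a b c d → (a + b) - (c + d) ≈ (a - c) + (b - d)
    +-‿-interchange a b c d = trans (+-congˡ (sym (⁻¹-∙-comm c d))) (interchange a b (- c) (- d))

    ⊖-correct : ∀ m n → ⟦ m ⊖ n ⟧ℤ ≈ m ×ᵣ 1# - n ×ᵣ 1#
    ⊖-correct zero    n       = ⟦⟧ℤ-correct zero n
    ⊖-correct (suc m) zero    = ⟦⟧ℤ-correct (suc m) zero
    ⊖-correct (suc m) (suc n) = begin
      ⟦ m ⊖ n ⟧ℤ                                  ≈⟨ ⊖-correct m n ⟩
      m ×ᵣ 1# - n ×ᵣ 1#                           ≈⟨ +-identityˡ _ ⟨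
      0# + (m ×ᵣ 1# - n ×ᵣ 1#)                    ≈⟨ +-congʳ (-‿inverseʳ 1#) ⟨
      (1# - 1#) + (m ×ᵣ 1# - n ×ᵣ 1#)             ≈⟨ +-‿-interchange 1# (m ×ᵣ 1#) 1# (n ×ᵣ 1#) ⟨
      (1# + m ×ᵣ 1#) - (1# + n ×ᵣ 1#)             ≈⟨ +-cong (×-homo-+ 1# 1 m) (-‿cong (×-homo-+ 1# 1 n)) ⟨
      suc m ×ᵣ 1# - suc n ×ᵣ 1#                   ∎

    [a-b][c-d]≈[ac+bd]-[ad+bc] : ∀ a b c d → (a - b) * (c - d) ≈ (a * c + b * d) - (a * d + b * c)
    [a-b][c-d]≈[ac+bd]-[ad+bc] a b c d = begin
      (a - b) * (c - d)                    ≈⟨ [y-z]x≈yx-zx (c - d) a b ⟩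
      a * (c - d) - b * (c - d)            ≈⟨ +-cong (x[y-z]≈xy-xz a c d) (-‿cong (x[y-z]≈xy-xz b c d)) ⟩
      (a * c - a * d) - (b * c - b * d)    ≈⟨ +-congˡ (⁻¹-anti-homo‿- (b * c) (b * d)) ⟩
      (a * c - a * d) + (b * d - b * c)    ≈⟨ +-‿-interchange _ _ _ _ ⟨
      (a * c + b * d) - (a * d + b * c)    ∎

  homomorphism : ℤ-rawRing -Raw-AlmostCommutative⟶ fromCommutativeRing R
  homomorphism = record
    { ⟦_⟧    = ⟦_⟧ℤ
    ; +-homo = λ (m , n) (m′ , n′) → begin
        ⟦ (m ℕ.+ m′) ⊖ (n ℕ.+ n′) ⟧ℤ
          ≈⟨ ⊖-correct (m ℕ.+ m′) (n ℕ.+ n′) ⟩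
        (m ℕ.+ m′) ×ᵣ 1# - (n ℕ.+ n′) ×ᵣ 1#
          ≈⟨ +-cong (×-homo-+ 1# m m′) (-‿cong (×-homo-+ 1# n n′)) ⟩
        (m ×ᵣ 1# + m′ ×ᵣ 1#) - (n ×ᵣ 1# + n′ ×ᵣ 1#)
          ≈⟨ +-‿-interchange _ _ _ _ ⟩
        (m ×ᵣ 1# - n ×ᵣ 1#) + (m′ ×ᵣ 1# - n′ ×ᵣ 1#)
          ≈⟨ +-cong (⟦⟧ℤ-correct m n) (⟦⟧ℤ-correct m′ n′) ⟨
        ⟦ m , n ⟧ℤ + ⟦ m′ , n′ ⟧ℤ
          ∎
    ; *-homo = λ (m , n) (m′ , n′) → begin
        ⟦ (m ℕ.* m′ ℕ.+ n ℕ.* n′) ⊖ (m ℕ.* n′ ℕ.+ n ℕ.* m′) ⟧ℤ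
          ≈⟨ ⊖-correct (m ℕ.* m′ ℕ.+ n ℕ.* n′) (m ℕ.* n′ ℕ.+ n ℕ.* m′) ⟩
        (m ℕ.* m′ ℕ.+ n ℕ.* n′) ×ᵣ 1# - (m ℕ.* n′ ℕ.+ n ℕ.* m′) ×ᵣ 1#
          ≈⟨ +-cong (expand m m′ n n′) (-‿cong (expand m n′ n m′)) ⟩
        (m ×ᵣ 1# * (m′ ×ᵣ 1#) + n ×ᵣ 1# * (n′ ×ᵣ 1#))
          - (m ×ᵣ 1# * (n′ ×ᵣ 1#) + n ×ᵣ 1# * (m′ ×ᵣ 1#))
          ≈⟨ [a-b][c-d]≈[ac+bd]-[ad+bc] _ _ _ _ ⟨
        (m ×ᵣ 1# - n ×ᵣ 1#) * (m′ ×ᵣ 1# - n′ ×ᵣ 1#)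
          ≈⟨ *-cong (⟦⟧ℤ-correct m n) (⟦⟧ℤ-correct m′ n′) ⟨
        ⟦ m , n ⟧ℤ * ⟦ m′ , n′ ⟧ℤ
          ∎
    ; -‿homo = λ (m , n) → begin
        ⟦ n , m ⟧ℤ                 ≈⟨ ⟦⟧ℤ-correct n m ⟩
        n ×ᵣ 1# - m ×ᵣ 1#          ≈⟨ ⁻¹-anti-homo‿- (m ×ᵣ 1#) (n ×ᵣ 1#) ⟨
        - (m ×ᵣ 1# - n ×ᵣ 1#)      ≈⟨ -‿cong (⟦⟧ℤ-correct m n) ⟨
        - ⟦ m , n ⟧ℤ               ∎
    ; 0-homo = refl
    ; 1-homo = refl
    }
    where
    expand : ∀ a b c d →
             (a ℕ.* b ℕ.+ c ℕ.* d) ×ᵣ 1# ≈ a ×ᵣ 1# * (b ×ᵣ 1#) + c ×ᵣ 1# * (d ×ᵣ 1#)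
    expand a b c d =
      trans (×-homo-+ 1# (a ℕ.* b) (c ℕ.* d)) (+-cong (×1-homo-* a b) (×1-homo-* c d))

  weaklyDecide : ∀ p q → Maybe (⟦ p ⟧ℤ ≈ ⟦ q ⟧ℤ)
  weaklyDecide p q with ≡-dec ℕ._≟_ ℕ._≟_ p q
  ... | yes ≡.refl = just refl
  ... | no _       = nothing

  open import Algebra.Solver.Ring ℤ-rawRing (fromCommutativeRing R) homomorphism weaklyDecide public

  :0 :1 : ∀ {n} → Polynomial n
  :0 = con (0 , 0)
  :1 = con (1 , 0)

module _ {c ℓ} (R : CommutativeRing c ℓ) where
  open CommutativeRing R hiding (zero)
  open IntegerCoefficientRingSolver R using (solve; _:=_; _:+_; _:-_; _:*_; :-_; :0; :1)
  open import Algebra.Properties.Ring ring using (-1*x≈-x)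
  open import Relation.Binary.Reasoning.Setoid setoid

  ∑ ∏ : (n : ℕ) → (Fin n → Carrier) → Carrier
  ∑ = ΣF R
  ∏ = ΠF R

  infixr 9 _⊛_
  infix  8 _∙_
  infixl 7 _·ᵢ_

  _⊛_ : ∀ {n} → (Fin n → Carrier) → (Fin n → Carrier) → Fin n → Carrier
  (u ⊛ v) j = u j * v j

  _∙_ : ∀ {n} → (Fin n → Carrier) → (Fin n → Carrier) → Carrier
  _∙_ {n} u v = ∑ n (u ⊛ v)

  _·ᵢ_ : Subset R → Subset R → Subset R
  _·ᵢ_ = _·_ R

  columnProduct : ∀ {n k} → (Fin n → Fin k → Carrier) → Fin k → Carrier
  columnProduct {n} A j = ∏ n (λ i → A i j)

  ∑-cong : ∀ n {f g : Fin n → Carrier} → (∀ j → f j ≈ g j) → ∑ n f ≈ ∑ n g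
  ∑-cong zero    f≈g = refl
  ∑-cong (suc n) f≈g = +-cong (f≈g fzero) (∑-cong n (f≈g ∘ fsuc))

  ∑-zero : ∀ n {f : Fin n → Carrier} → (∀ j → f j ≈ 0#) → ∑ n f ≈ 0#
  ∑-zero zero    f≈0 = refl
  ∑-zero (suc n) f≈0 = trans (+-cong (f≈0 fzero) (∑-zero n (f≈0 ∘ fsuc))) (+-identityʳ 0#)

  ∑-distribˡ : ∀ n s (f : Fin n → Carrier) → s * ∑ n f ≈ ∑ n (λ j → s * f j)
  ∑-distribˡ zero    s f = zeroʳ s
  ∑-distribˡ (suc n) s f = trans (distribˡ s _ _) (+-congˡ (∑-distribˡ n s (f ∘ fsuc)))

  ∑-linear : ∀ n s t {f g h : Fin n → Carrier} → (∀ j → h j ≈ s * f j + t * g j) →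
             ∑ n h ≈ s * ∑ n f + t * ∑ n g
  ∑-linear zero    s t h≈ = solve 2 (λ s t → :0 := s :* :0 :+ t :* :0) refl s t
  ∑-linear (suc n) s t {f} {g} {h} h≈ = begin
    h fzero + ∑ n (h ∘ fsuc)                          ≈⟨ +-cong (h≈ fzero) (∑-linear n s t (h≈ ∘ fsuc)) ⟩
    (s * f fzero + t * g fzero) + (s * F + t * G)     ≈⟨ solve 6 (λ s t a b A B →
                                                           (s :* a :+ t :* b) :+ (s :* A :+ t :* B)
                                                             := s :* (a :+ A) :+ t :* (b :+ B))
                                                         refl s t (f fzero) (g fzero) F G ⟩
    s * (f fzero + F) + t * (g fzero + G)              ∎
    where
    F = ∑ n (f ∘ fsuc)
    G = ∑ n (g ∘ fsuc)

  ∑-++ : ∀ m {n} (f : Fin m → Carrier) (g : Fin n → Carrier) → ∑ (m ℕ.+ n) (f ++ g) ≈ ∑ m f + ∑ n g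
  ∑-++ zero    f g = sym (+-identityˡ _)
  ∑-++ (suc m) f g = begin
    f fzero + ∑ _ ((f ++ g) ∘ fsuc)       ≈⟨ +-congˡ (∑-cong _ (reflexive ∘ [,]-map ∘ splitAt m)) ⟩
    f fzero + ∑ _ ((f ∘ fsuc) ++ g)       ≈⟨ +-congˡ (∑-++ m (f ∘ fsuc) g) ⟩
    f fzero + (∑ m (f ∘ fsuc) + ∑ _ g)    ≈⟨ +-assoc _ _ _ ⟨
    ∑ (suc m) f + ∑ _ g                   ∎

  ⊛-++ : ∀ m {n} (a b : Fin m → Carrier) (a′ b′ : Fin n → Carrier) →
         ∀ t → ((a ++ a′) ⊛ (b ++ b′)) t ≡ ((a ⊛ b) ++ (a′ ⊛ b′)) t
  ⊛-++ m a b a′ b′ t with splitAt m t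
  ... | inj₁ _ = ≡.refl
  ... | inj₂ _ = ≡.refl

  ∙-⊛-swap : ∀ {k} (a b c : Fin k → Carrier) → a ∙ (b ⊛ c) ≈ b ∙ (a ⊛ c)
  ∙-⊛-swap {k} a b c =
    ∑-cong k λ j → solve 3 (λ a b c → a :* (b :* c) := b :* (a :* c)) refl (a j) (b j) (c j)

  𝟙-unital : ∀ k → Unital R (suc k) (λ _ → 1#)
  𝟙-unital k = 1# ∷ (λ _ → 0#) ,
               trans (+-cong (*-identityʳ 1#) (∑-zero k (λ _ → zeroˡ 1#))) (+-identityʳ 1#)

  module IdealProperties {I : Subset R} (isIdeal : IsIdeal R I) where
    open IsIdeal isIdeal public

    ≈0⇒∈ : ∀ {x} → x ≈ 0# → I x
    ≈0⇒∈ x≈0 = resp (sym x≈0) zero∈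

    *∈ʳ : ∀ {x} a → I x → I (x * a)
    *∈ʳ a x∈I = resp (*-comm a _) (*∈ a x∈I)

    -∈ : ∀ {x} → I x → I (- x)
    -∈ {x} x∈I = resp (-1*x≈-x x) (*∈ (- 1#) x∈I)

    ∑∈ : ∀ n {f : Fin n → Carrier} → (∀ j → I (f j)) → I (∑ n f)
    ∑∈ zero    f∈I = zero∈
    ∑∈ (suc n) f∈I = +∈ (f∈I fzero) (∑∈ n (f∈I ∘ fsuc))

    ∑-cong-mod : ∀ n {f g : Fin n → Carrier} → (∀ j → I (f j - g j)) → I (∑ n f - ∑ n g)
    ∑-cong-mod n {f} {g} f≡g = resp sums (∑∈ n f≡g)
      where
      sums : ∑ n (λ j → f j - g j) ≈ ∑ n f - ∑ n g
      sums = trans (∑-linear n 1# (- 1#) λ j →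
                      solve 2 (λ a b → a :- b := :1 :* a :+ (:- :1) :* b) refl (f j) (g j))
                   (solve 2 (λ a b → :1 :* a :+ (:- :1) :* b := a :- b) refl (∑ n f) (∑ n g))

    *-≡1 : ∀ {x y} → I (x - 1#) → I (y - 1#) → I (x * y - 1#)
    *-≡1 {x} {y} x≡1 y≡1 = resp (solve 2 (λ x y → (x :- :1) :* y :+ (y :- :1) := x :* y :- :1) refl x y)
                                (+∈ (*∈ʳ y x≡1) y≡1)

    ∏∈ : ∀ n {f : Fin n → Carrier} l → I (f l) → I (∏ n f)
    ∏∈ (suc n) fzero    f∈I = *∈ʳ _ f∈I
    ∏∈ (suc n) {f} (fsuc l) f∈I = *∈ (f fzero) (∏∈ n l f∈I)

    ∏-≡1 : ∀ n {f : Fin n → Carrier} → (∀ j → I (f j - 1#)) → I (∏ n f - 1#)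
    ∏-≡1 zero    f≡1 = ≈0⇒∈ (-‿inverseʳ 1#)
    ∏-≡1 (suc n) f≡1 = *-≡1 (f≡1 fzero) (∏-≡1 n (f≡1 ∘ fsuc))

  UnitIdeal-isIdeal : IsIdeal R (UnitIdeal R)
  UnitIdeal-isIdeal = record { resp = λ _ _ → tt ; zero∈ = tt ; +∈ = λ _ _ → tt ; *∈ = λ _ _ → tt }

  module _ {I J : Subset R} (isIdealᴵ : IsIdeal R I) (isIdealᴶ : IsIdeal R J) where
    private
      module I = IdealProperties isIdealᴵ
      module J = IdealProperties isIdealᴶ

    ·-isIdeal : IsIdeal R (I ·ᵢ J)
    ·-isIdeal = record
      { resp  = λ { x≈y (n , a , b , ab∈ , x≈∑) → n , a , b , ab∈ , trans (sym x≈y) x≈∑ }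
      ; zero∈ = 0 , (λ ()) , (λ ()) , ((λ ()) , (λ ())) , refl
      ; +∈    = λ { (m , a , b , (a∈ , b∈) , x≈) (n , a′ , b′ , (a′∈ , b′∈) , y≈) →
                      m ℕ.+ n , a ++ a′ , b ++ b′ ,
                      (++⁺ I a∈ a′∈ , ++⁺ J b∈ b′∈) ,
                      trans (+-cong x≈ y≈)
                            (sym (trans (∑-cong _ (reflexive ∘ ⊛-++ m a b a′ b′))
                                        (∑-++ m (a ⊛ b) (a′ ⊛ b′)))) }
      ; *∈    = λ { s (n , a , b , (a∈ , b∈) , x≈) →
                      n , (λ t → s * a t) , b , ((λ t → I.*∈ s (a∈ t)) , b∈) ,
                      trans (*-congˡ x≈) (trans (∑-distribˡ n s _) (∑-cong n λ t → sym (*-assoc _ _ _))) }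
      }

    ·⊆ˡ : ∀ {x} → (I ·ᵢ J) x → I x
    ·⊆ˡ (n , a , b , (a∈ , _) , x≈) = I.resp (sym x≈) (I.∑∈ n λ t → I.*∈ʳ (b t) (a∈ t))

    ·⊆ʳ : ∀ {x} → (I ·ᵢ J) x → J x
    ·⊆ʳ (n , a , b , (_ , b∈) , x≈) = J.resp (sym x≈) (J.∑∈ n λ t → J.*∈ (a t) (b∈ t))

    *∈· : ∀ {x y} → I x → J y → (I ·ᵢ J) (x * y)
    *∈· {x} {y} x∈ y∈ = 1 , (λ _ → x) , (λ _ → y) , ((λ _ → x∈) , (λ _ → y∈)) , sym (+-identityʳ _)

    inverse-mod-· : ∀ {x y z} → I (x * y - 1#) → J (x * z - 1#) → (I ·ᵢ J) (x * (y + z - x * y * z) - 1#)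
    inverse-mod-· {x} {y} {z} xy≡1 xz≡1 =
      ·-isIdeal .IsIdeal.resp
        (solve 3 (λ x y z → (x :* y :- :1) :* (:- (x :* z :- :1)) := x :* (y :+ z :- x :* y :* z) :- :1) refl x y z)
        (*∈· xy≡1 (J.-∈ xz≡1))

  ΠIdeal-isIdeal : ∀ n (P : Fin n → Subset R) → (∀ t → IsIdeal R (P t)) → IsIdeal R (ΠIdeal R n P)
  ΠIdeal-isIdeal zero    P P-isIdeal = UnitIdeal-isIdeal
  ΠIdeal-isIdeal (suc n) P P-isIdeal =
    ·-isIdeal (P-isIdeal fzero) (ΠIdeal-isIdeal n (P ∘ fsuc) (P-isIdeal ∘ fsuc))

  module _ {M : Subset R} (M-maximal : IsMaximal R M) where
    open IdealProperties (IsMaximal.ideal M-maximal)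

    private
      M+⟨_⟩ : Carrier → Subset R
      M+⟨ a ⟩ x = Σ Carrier λ m → Σ Carrier λ ρ → M m × x ≈ m + ρ * a

      M+⟨⟩-isIdeal : ∀ a → IsIdeal R M+⟨ a ⟩
      M+⟨⟩-isIdeal a = record
        { resp  = λ { x≈y (m , ρ , m∈ , x≈) → m , ρ , m∈ , trans (sym x≈y) x≈ }
        ; zero∈ = 0# , 0# , zero∈ , solve 1 (λ a → :0 := :0 :+ :0 :* a) refl a
        ; +∈    = λ { (m , ρ , m∈ , x≈) (m′ , ρ′ , m′∈ , y≈) →
                        m + m′ , ρ + ρ′ , +∈ m∈ m′∈ ,
                        trans (+-cong x≈ y≈) (solve 5 (λ m ρ m′ ρ′ a → (m :+ ρ :* a) :+ (m′ :+ ρ′ :* a)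
                                                         := (m :+ m′) :+ (ρ :+ ρ′) :* a) refl m ρ m′ ρ′ a) }
        ; *∈    = λ { s (m , ρ , m∈ , x≈) →
                        s * m , s * ρ , *∈ s m∈ ,
                        trans (*-congˡ x≈) (solve 4 (λ s m ρ a → s :* (m :+ ρ :* a) := s :* m :+ (s :* ρ) :* a)
                                                    refl s m ρ a) }
        }

      M⊆M+⟨⟩ : ∀ a x → M x → M+⟨ a ⟩ x
      M⊆M+⟨⟩ a x x∈M = x , 0# , x∈M , solve 2 (λ x a → x := x :+ :0 :* a) refl x a

    ∈⊎invertible-mod : ∀ a → M a ⊎ Σ Carrier λ ρ → M (a * ρ - 1#)
    ∈⊎invertible-mod a with IsMaximal.maximal M-maximal M+⟨ a ⟩ (M+⟨⟩-isIdeal a) (M⊆M+⟨⟩ a)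
    ... | inj₁ M+⟨a⟩⊆M = inj₁ (M+⟨a⟩⊆M a (0# , 1# , zero∈ , solve 1 (λ a → a := :0 :+ :1 :* a) refl a))
    ... | inj₂ M+⟨a⟩≐R with M+⟨a⟩≐R 1#
    ...   | m , ρ , m∈ , 1≈m+ρa = inj₂ (ρ , resp aρ-1≈-m (-∈ m∈))
      where
      aρ-1≈-m : - m ≈ a * ρ - 1#
      aρ-1≈-m = trans (solve 3 (λ m ρ a → :- m := a :* ρ :- (m :+ ρ :* a)) refl m ρ a)
                      (+-congˡ (-‿cong (sym 1≈m+ρa)))

  -- sr(R/J) = 1, the stable range condition for the quotient ring R/J.
  StableRangeOne : Subset R → Set (c ⊔ ℓ)
  StableRangeOne J = ∀ a b x y → J (a * x + b * y - 1#) →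
                     Σ Carrier λ τ → Σ Carrier λ w → J ((a + τ * b) * w - 1#)

  UnitIdeal-stableRangeOne : StableRangeOne (UnitIdeal R)
  UnitIdeal-stableRangeOne a b x y _ = 0# , 0# , tt

  module _ {P Q : Subset R} (P-maximal : IsMaximal R P) (Q-isIdeal : IsIdeal R Q) where
    private
      P-isIdeal = IsMaximal.ideal P-maximal
      module P-ideal = IdealProperties P-isIdeal
      module Q-ideal = IdealProperties Q-isIdeal

    -- If a′ = a + τ b is invertible modulo Q but lies in P, then q = 1 − a′ w lies in Q and
    -- is ≡ 1 modulo P, so that a + (τ + q) b ≡ b modulo P, where b is invertible.
    ·-stableRangeOne : StableRangeOne Q → StableRangeOne (P ·ᵢ Q)
    ·-stableRangeOne Q-sr a b x y ax+by≡1 with Q-sr a b x y (·⊆ʳ P-isIdeal Q-isIdeal ax+by≡1)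
    ... | τ , w , a′w≡1 with ∈⊎invertible-mod P-maximal (a + τ * b)
    ...   | inj₂ (ρ , a′ρ≡1) = τ , _ , inverse-mod-· P-isIdeal Q-isIdeal a′ρ≡1 a′w≡1
    ...   | inj₁ a′∈P = τ + (1# - (a + τ * b) * w) , _ , inverse-mod-· P-isIdeal Q-isIdeal modP modQ
      where
      modP : P ((a + (τ + (1# - (a + τ * b) * w)) * b) * (y - τ * x) - 1#)
      modP = P-ideal.resp
        (solve 6 (λ a b x y τ w →
           (a :+ τ :* b) :* ((y :- τ :* x) :- w :* b :* (y :- τ :* x) :- x) :+ (a :* x :+ b :* y :- :1)
           := (a :+ (τ :+ (:1 :- (a :+ τ :* b) :* w)) :* b) :* (y :- τ :* x) :- :1) refl a b x y τ w)
        (P-ideal.+∈ (P-ideal.*∈ʳ _ a′∈P) (·⊆ˡ P-isIdeal Q-isIdeal ax+by≡1))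
      modQ : Q ((a + (τ + (1# - (a + τ * b) * w)) * b) * w - 1#)
      modQ = Q-ideal.resp
        (solve 4 (λ a b τ w → ((a :+ τ :* b) :* w :- :1) :* (:1 :- b :* w)
           := (a :+ (τ :+ (:1 :- (a :+ τ :* b) :* w)) :* b) :* w :- :1) refl a b τ w)
        (Q-ideal.*∈ʳ _ a′w≡1)

  ΠIdeal-stableRangeOne : ∀ n (P : Fin n → Subset R) → (∀ t → IsMaximal R (P t)) →
                          StableRangeOne (ΠIdeal R n P)
  ΠIdeal-stableRangeOne zero    P P-maximal = UnitIdeal-stableRangeOne
  ΠIdeal-stableRangeOne (suc n) P P-maximal =
    ·-stableRangeOne (P-maximal fzero) (ΠIdeal-isIdeal n (P ∘ fsuc) (IsMaximal.ideal ∘ P-maximal ∘ fsuc))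
      (ΠIdeal-stableRangeOne n (P ∘ fsuc) (P-maximal ∘ fsuc))

  InMonoidM⇒isIdeal : ∀ {I} → InMonoidM R I → IsIdeal R I
  InMonoidM⇒isIdeal (n , P , P-maximal , I⊆ΠP , ΠP⊆I) = record
    { resp  = λ x≈y x∈I → ΠP⊆I _ (ΠP.resp x≈y (I⊆ΠP _ x∈I))
    ; zero∈ = ΠP⊆I _ ΠP.zero∈
    ; +∈    = λ x∈I y∈I → ΠP⊆I _ (ΠP.+∈ (I⊆ΠP _ x∈I) (I⊆ΠP _ y∈I))
    ; *∈    = λ s x∈I → ΠP⊆I _ (ΠP.*∈ s (I⊆ΠP _ x∈I))
    }
    where module ΠP = IsIdeal (ΠIdeal-isIdeal n P (IsMaximal.ideal ∘ P-maximal))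

  InMonoidM⇒stableRangeOne : ∀ {I} → InMonoidM R I → StableRangeOne I
  InMonoidM⇒stableRangeOne (n , P , P-maximal , I⊆ΠP , ΠP⊆I) a b x y ax+by≡1 =
    let (τ , w , a′w≡1) = ΠIdeal-stableRangeOne n P P-maximal a b x y (I⊆ΠP _ ax+by≡1)
    in τ , w , ΠP⊆I _ a′w≡1

  module _ {r} {I : Fin r → Subset R} (isIdeal : ∀ i → IsIdeal R (I i))
           (comaximal : ∀ i j → i ≢ j → Comaximal R (I i) (I j)) where
    private
      module Ideal i = IdealProperties (isIdeal i)

      factor : ∀ i l → Σ Carrier λ f → I i (f - 1#) × (l ≢ i → I l f)
      factor i l with i ≟ l
      ... | yes ≡.refl = 1# , Ideal.≈0⇒∈ i (-‿inverseʳ 1#) , λ i≢i → ⊥-elim (i≢i ≡.refl)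
      ... | no i≢l with comaximal i l i≢l
      ...   | x , y , x∈Iᵢ , y∈Iₗ , x+y≈1 = y , Ideal.resp i -x≈y-1 (Ideal.-∈ i x∈Iᵢ) , λ _ → y∈Iₗ
        where
        -x≈y-1 : - x ≈ y - 1#
        -x≈y-1 = trans (solve 2 (λ x y → :- x := y :- (x :+ y)) refl x y) (+-congˡ (-‿cong x+y≈1))

    chineseRemainderBasis :
      Σ (Fin r → Carrier) λ e → (∀ i → I i (e i - 1#)) × (∀ i l → l ≢ i → I l (e i))
    chineseRemainderBasis =
      (λ i → ∏ r λ l → proj₁ (factor i l)) ,
      (λ i → Ideal.∏-≡1 i r λ l → proj₁ (proj₂ (factor i l))) ,
      (λ i l l≢i → Ideal.∏∈ l r l (proj₂ (proj₂ (factor i l)) l≢i))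

  ProportionalMod : Subset R → ∀ {k} → (Fin k → Carrier) → (Fin k → Carrier) → Set (c ⊔ ℓ)
  ProportionalMod I a v = Σ Carrier λ μ → ∀ j → I (a j - μ * v j)

  ProportionalMod⇒PFEquiv : ∀ {I k} (a v : Fin k → Carrier) → IsIdeal R I →
                            ProportionalMod I a v → PFEquiv R I k a v
  ProportionalMod⇒PFEquiv a v isIdeal (μ , a≡μv) i j _ =
    resp (solve 5 (λ ai aj vi vj μ → (ai :- μ :* vi) :* vj :- (aj :- μ :* vj) :* vi := ai :* vj :- aj :* vi)
                  refl (a i) (a j) (v i) (v j) μ)
         (+∈ (*∈ʳ (v j) (a≡μv i)) (-∈ (*∈ʳ (v i) (a≡μv j))))
    where open IdealProperties isIdeal

  ProportionalMod-resp-≡ : ∀ {J k} (a a′ v : Fin k → Carrier) → IsIdeal R J → (∀ j → J (a j - a′ j)) →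
                           ProportionalMod J a′ v → ProportionalMod J a v
  ProportionalMod-resp-≡ a a′ v isIdeal a≡a′ (μ , a′≡μv) = μ , λ j →
    resp (solve 3 (λ a a′ μv → (a :- a′) :+ (a′ :- μv) := a :- μv) refl (a j) (a′ j) (μ * v j))
         (+∈ (a≡a′ j) (a′≡μv j))
    where open IdealProperties isIdeal

  ∙-⊛-≡1-mod : ∀ {I k} (x b v P : Fin k → Carrier) → IsIdeal R I → (∀ j → I (P j - 1#)) →
               (∀ j → I (x j - b j)) → b ∙ v ≈ 1# → I (x ∙ (v ⊛ P) - 1#)
  ∙-⊛-≡1-mod {k = k} x b v P isIdeal P≡1 x≡b b∙v≈1 =
    resp (+-congˡ (-‿cong b∙v≈1)) (∑-cong-mod k λ j →
      resp (solve 4 (λ x b v P → (x :- b) :* v :* P :+ b :* v :* (P :- :1) := x :* (v :* P) :- b :* v)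
                    refl (x j) (b j) (v j) (P j))
           (+∈ (*∈ʳ (P j) (*∈ʳ (v j) (x≡b j))) (*∈ (b j * v j) (P≡1 j))))
    where open IdealProperties isIdeal

  perturb : ∀ {k} → (Q α x : Fin k → Carrier) → Carrier → Fin k → Carrier
  perturb Q α x τ j = α j + τ * (x j - (x ∙ Q) * α j)

  perturb-∙ : ∀ {k} (Q α x u : Fin k → Carrier) τ →
              perturb Q α x τ ∙ u ≈ α ∙ u + τ * (x ∙ u - (x ∙ Q) * (α ∙ u))
  perturb-∙ {k} Q α x u τ = begin
    perturb Q α x τ ∙ u
      ≈⟨ ∑-linear k 1# τ (λ j → solve 5 (λ α τ x q u →
           (α :+ τ :* (x :- q :* α)) :* u := :1 :* (α :* u) :+ τ :* (x :* u :- q :* (α :* u)))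
           refl (α j) τ (x j) (x ∙ Q) (u j)) ⟩
    1# * α ∙ u + τ * ∑ k (λ j → x j * u j - (x ∙ Q) * (α j * u j))
      ≈⟨ +-cong (*-identityˡ _) (*-congˡ (∑-linear k 1# (- (x ∙ Q)) λ j →
           solve 3 (λ a b q → a :- q :* b := :1 :* a :+ (:- q) :* b) refl (x j * u j) (α j * u j) (x ∙ Q))) ⟩
    α ∙ u + τ * (1# * x ∙ u + - (x ∙ Q) * α ∙ u)
      ≈⟨ +-congˡ (*-congˡ (solve 3 (λ a b q → :1 :* a :+ (:- q) :* b := a :- q :* b)
                                   refl (x ∙ u) (α ∙ u) (x ∙ Q))) ⟩
    α ∙ u + τ * (x ∙ u - (x ∙ Q) * (α ∙ u))
      ∎

  perturb-∙-invariant : ∀ {k} (Q α x : Fin k → Carrier) τ → α ∙ Q ≈ 1# → perturb Q α x τ ∙ Q ≈ 1#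
  perturb-∙-invariant Q α x τ α∙Q≈1 = begin
    perturb Q α x τ ∙ Q
      ≈⟨ perturb-∙ Q α x Q τ ⟩
    α ∙ Q + τ * (x ∙ Q - (x ∙ Q) * (α ∙ Q))
      ≈⟨ +-cong α∙Q≈1 (*-congˡ (+-congˡ (-‿cong (*-congˡ α∙Q≈1)))) ⟩
    1# + τ * (x ∙ Q - (x ∙ Q) * 1#)
      ≈⟨ solve 2 (λ τ q → :1 :+ τ :* (q :- q :* :1) := :1) refl τ (x ∙ Q) ⟩
    1#
      ∎

  perturb-≡ : ∀ {J k} (Q α x : Fin k → Carrier) τ → IsIdeal R J → (∀ j → J (x j)) →
              ∀ j → J (perturb Q α x τ j - α j)
  perturb-≡ {k = k} Q α x τ isIdeal x∈J j =
    resp (solve 4 (λ α τ x q → τ :* (x :- q :* α) := α :+ τ :* (x :- q :* α) :- α)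
                  refl (α j) τ (x j) (x ∙ Q))
         (*∈ τ (+∈ (x∈J j) (-∈ (*∈ʳ (α j) (∑∈ k λ i → *∈ʳ (Q i) (x∈J i))))))
    where open IdealProperties isIdeal

  -- With p = α ∙ w and q = x ∙ Q the pair (p , x ∙ w − q p) is unimodular modulo I,
  -- and perturbing α by τ turns α ∙ w into p + τ (x ∙ w − q p).
  invertible-perturbation : ∀ {I k} (Q α x w : Fin k → Carrier) → IsIdeal R I → StableRangeOne I →
    α ∙ Q ≈ 1# → I (x ∙ w - 1#) →
    Σ (Fin k → Carrier) λ γ → γ ∙ Q ≈ 1# × (Σ Carrier λ W → I ((γ ∙ w) * W - 1#)) ×
                              (∀ {J} → IsIdeal R J → (∀ j → J (x j)) → ∀ j → J (γ j - α j))
  invertible-perturbation {I} Q α x w isIdeal sr α∙Q≈1 x∙w≡1 =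
    let (τ , W , invertible) = sr p (x ∙ w - q * p) q 1# unimodular
    in perturb Q α x τ , perturb-∙-invariant Q α x τ α∙Q≈1 ,
       (W , resp (+-congʳ (*-congʳ (sym (perturb-∙ Q α x w τ)))) invertible) ,
       λ J-isIdeal → perturb-≡ Q α x τ J-isIdeal
    where
    open IdealProperties isIdeal
    p q : Carrier
    p = α ∙ w
    q = x ∙ Q
    unimodular : I (p * q + (x ∙ w - q * p) * 1# - 1#)
    unimodular = resp (solve 3 (λ p q s → s :- :1 := p :* q :+ (s :- q :* p) :* :1 :- :1) refl p q (x ∙ w))
                      x∙w≡1

  affineRow : ∀ {k} → Carrier → (v c u : Fin k → Carrier) → Fin k → Carrier
  affineRow μ v c u j = μ * v j + (1# - μ * (v ∙ u)) * c j

  affineRow-∙ : ∀ {k} μ (v c u : Fin k → Carrier) → c ∙ u ≈ 1# → affineRow μ v c u ∙ u ≈ 1#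
  affineRow-∙ {k} μ v c u c∙u≈1 = begin
    affineRow μ v c u ∙ u
      ≈⟨ ∑-linear k μ λ′ (λ j → solve 5 (λ μ v λ′ c u →
           (μ :* v :+ λ′ :* c) :* u := μ :* (v :* u) :+ λ′ :* (c :* u)) refl μ (v j) λ′ (c j) (u j)) ⟩
    μ * (v ∙ u) + λ′ * (c ∙ u)
      ≈⟨ +-congˡ (*-congˡ c∙u≈1) ⟩
    μ * (v ∙ u) + (1# - μ * (v ∙ u)) * 1#
      ≈⟨ solve 1 (λ s → s :+ (:1 :- s) :* :1 := :1) refl (μ * (v ∙ u)) ⟩
    1#
      ∎
    where
    λ′ = 1# - μ * (v ∙ u)

  affineRow-proportional : ∀ {I k} μ (v c u : Fin k → Carrier) → IsIdeal R I →
                           I (μ * (v ∙ u) - 1#) → ProportionalMod I (affineRow μ v c u) v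
  affineRow-proportional μ v c u isIdeal μS≡1 = μ , λ j →
    resp (solve 4 (λ μ v s c → (:- (s :- :1)) :* c := μ :* v :+ (:1 :- s) :* c :- μ :* v)
                  refl μ (v j) (μ * (v ∙ u)) (c j))
         (*∈ʳ (c j) (-∈ μS≡1))
    where open IdealProperties isIdeal

  affineRow-𝟙-≡1 : ∀ {J k} μ (v u : Fin k → Carrier) → IsIdeal R J → J μ →
                   ∀ j → J (affineRow μ v (λ _ → 1#) u j - 1#)
  affineRow-𝟙-≡1 μ v u isIdeal μ∈J j =
    resp (solve 3 (λ μ v s → μ :* (v :- s) := μ :* v :+ (:1 :- μ :* s) :* :1 :- :1) refl μ (v j) (v ∙ u))
         (*∈ʳ _ μ∈J)
    where open IdealProperties isIdeal

  extendRow : ∀ {I k} (P β x v : Fin k → Carrier) e → IsIdeal R I → StableRangeOne I →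
    β ∙ P ≈ 1# → I (x ∙ (v ⊛ P) - 1#) → I (e - 1#) →
    Σ (Fin k → Carrier) λ a → Unital R k (a ⊛ P) × ProportionalMod I a v ×
                              (∀ {J} → IsIdeal R J → J e → ∀ j → J (a j - 1#))
  extendRow {I} {k} P β x v e isIdeal sr β∙P≈1 x∙vP≡1 e≡1 =
    let (γ , γ∙P≈1 , (W , γ∙vP·W≡1) , _) =
          invertible-perturbation P β x (v ⊛ P) isIdeal sr β∙P≈1 x∙vP≡1
    in affineRow (W * e) v (λ _ → 1#) (γ ⊛ P) , extension γ W γ∙P≈1 γ∙vP·W≡1
    where
    open IdealProperties isIdeal
    extension : ∀ γ W → γ ∙ P ≈ 1# → I ((γ ∙ (v ⊛ P)) * W - 1#) →
      let a = affineRow (W * e) v (λ _ → 1#) (γ ⊛ P) in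
      Unital R k (a ⊛ P) × ProportionalMod I a v × (∀ {J} → IsIdeal R J → J e → ∀ j → J (a j - 1#))
    extension γ W γ∙P≈1 γ∙vP·W≡1 =
      (γ , trans (∙-⊛-swap γ a P) (affineRow-∙ (W * e) v (λ _ → 1#) (γ ⊛ P) 𝟙∙γP≈1)) ,
      affineRow-proportional (W * e) v (λ _ → 1#) (γ ⊛ P) isIdeal WeS≡1 ,
      λ J-isIdeal e∈J → affineRow-𝟙-≡1 (W * e) v (γ ⊛ P) J-isIdeal (IsIdeal.*∈ J-isIdeal W e∈J)
      where
      a = affineRow (W * e) v (λ _ → 1#) (γ ⊛ P)
      S = γ ∙ (v ⊛ P)
      𝟙∙γP≈1 : (λ _ → 1#) ∙ (γ ⊛ P) ≈ 1#
      𝟙∙γP≈1 = trans (∑-cong k λ j → *-identityˡ (γ j * P j)) γ∙P≈1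
      WeS≡1 : I (W * e * (v ∙ (γ ⊛ P)) - 1#)
      WeS≡1 = resp (trans (solve 3 (λ S W e → S :* W :- :1 :+ S :* W :* (e :- :1) := W :* e :* S :- :1) refl S W e)
                          (+-congʳ (*-congˡ (sym (∙-⊛-swap v γ P)))))
                   (+∈ γ∙vP·W≡1 (*∈ (S * W) e≡1))

  -- a is perturbed by multiples of x, hence only modulo I₁, until v ∙ (a₁ ⊛ P) is invertible
  -- modulo I₀; then the affine row a₀ is proportional to v modulo I₀.
  closeRows : ∀ {I₀ I₁ k} (P a γ x v : Fin k → Carrier) →
    IsIdeal R I₀ → IsIdeal R I₁ → StableRangeOne I₀ →
    γ ∙ (a ⊛ P) ≈ 1# → I₀ (x ∙ (v ⊛ P) - 1#) → (∀ j → I₁ (x j)) →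
    Σ (Fin k → Carrier) λ a₀ → Σ (Fin k → Carrier) λ a₁ →
      a₀ ∙ (a₁ ⊛ P) ≈ 1# × ProportionalMod I₀ a₀ v × (∀ j → I₁ (a₁ j - a j))
  closeRows {I₀} P a γ x v isIdeal₀ isIdeal₁ sr₀ γ∙aP≈1 x∙vP≡1 x∈I₁ =
    let (a₁ , a₁∙γP≈1 , (W , a₁∙vP·W≡1) , a₁≡a) =
          invertible-perturbation (γ ⊛ P) a x (v ⊛ P) isIdeal₀ sr₀
            (trans (∙-⊛-swap a γ P) γ∙aP≈1) x∙vP≡1
        (a₀∙a₁P≈1 , a₀∝v) = closing a₁ W a₁∙γP≈1 a₁∙vP·W≡1
    in affineRow W v γ (a₁ ⊛ P) , a₁ , a₀∙a₁P≈1 , a₀∝v , a₁≡a isIdeal₁ x∈I₁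
    where
    closing : ∀ a₁ W → a₁ ∙ (γ ⊛ P) ≈ 1# → I₀ ((a₁ ∙ (v ⊛ P)) * W - 1#) →
              affineRow W v γ (a₁ ⊛ P) ∙ (a₁ ⊛ P) ≈ 1# × ProportionalMod I₀ (affineRow W v γ (a₁ ⊛ P)) v
    closing a₁ W a₁∙γP≈1 a₁∙vP·W≡1 =
      affineRow-∙ W v γ (a₁ ⊛ P) (trans (∙-⊛-swap γ a₁ P) a₁∙γP≈1) ,
      affineRow-proportional W v γ (a₁ ⊛ P) isIdeal₀
        (IsIdeal.resp isIdeal₀
          (+-congʳ (trans (*-comm (a₁ ∙ (v ⊛ P)) W) (*-congˡ (sym (∙-⊛-swap v a₁ P))))) a₁∙vP·W≡1)

  module RowConstruction
    {r k : ℕ} {I : Fin r → Subset R}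
    (isIdeal : ∀ i → IsIdeal R (I i)) (stableRangeOne : ∀ i → StableRangeOne (I i))
    (comaximal : ∀ i j → i ≢ j → Comaximal R (I i) (I j))
    (v : Fin r → Fin k → Carrier) (v-unital : ∀ i → Unital R k (v i))
    where

    private
      module Ideal i = IdealProperties (isIdeal i)

      e : Fin r → Carrier
      e = proj₁ (chineseRemainderBasis isIdeal comaximal)

      e≡1 : ∀ i → I i (e i - 1#)
      e≡1 = proj₁ (proj₂ (chineseRemainderBasis isIdeal comaximal))

      e∈ : ∀ i l → l ≢ i → I l (e i)
      e∈ = proj₂ (proj₂ (chineseRemainderBasis isIdeal comaximal))

      b : Fin r → Fin k → Carrier
      b i = proj₁ (v-unital i)

      e·b : Fin r → Fin k → Carrier
      e·b i j = e i * b i j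

      b-unimodular : ∀ i (P : Fin k → Carrier) → (∀ j → I i (P j - 1#)) → I i (b i ∙ (v i ⊛ P) - 1#)
      b-unimodular i P P≡1 = ∙-⊛-≡1-mod (b i) (b i) (v i) P (isIdeal i) P≡1
        (λ j → Ideal.≈0⇒∈ i (-‿inverseʳ (b i j))) (proj₂ (v-unital i))

      e·b-unimodular : ∀ i (P : Fin k → Carrier) → (∀ j → I i (P j - 1#)) → I i (e·b i ∙ (v i ⊛ P) - 1#)
      e·b-unimodular i P P≡1 = ∙-⊛-≡1-mod (e·b i) (b i) (v i) P (isIdeal i) P≡1
        (λ j → Ideal.resp i (solve 2 (λ e b → (e :- :1) :* b := e :* b :- b) refl (e i) (b i j))
                            (Ideal.*∈ʳ i (b i j) (e≡1 i)))
        (proj₂ (v-unital i))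

    -- Only the specifications of these constructions are ever used; keeping them opaque stops
    -- the type checker from unfolding the witnesses when comparing types.
    opaque
      buildRows : Unital R k (λ _ → 1#) → ∀ n (f : Fin n → Fin r) → Injective _≡_ _≡_ f →
        Σ (Fin n → Fin k → Carrier) λ a → Unital R k (columnProduct a) ×
          (∀ t → ProportionalMod (I (f t)) (a t) (v (f t))) ×
          (∀ l → (∀ t → f t ≢ l) → ∀ j → I l (columnProduct a j - 1#))
      buildRows unital-𝟙 zero    f f-injective =
        (λ ()) , unital-𝟙 , (λ ()) , λ l _ _ → Ideal.≈0⇒∈ l (-‿inverseʳ 1#)
      buildRows unital-𝟙 (suc n) f f-injective =
        let (a , (β , β∙P≈1) , a∝v , P≡1) =
              buildRows unital-𝟙 n (f ∘ fsuc) (λ eq → suc-injective (f-injective eq))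
            i = f fzero
            P = columnProduct a
            (a₀ , a₀P-unital , a₀∝v , a₀≡1) =
              extendRow P β (b i) (v i) (e i) (isIdeal i) (stableRangeOne i) β∙P≈1
                (b-unimodular i P (P≡1 i λ t fₜ≡i → 0≢1+n (≡.sym (f-injective fₜ≡i)))) (e≡1 i)
        in a₀ ∷ a , a₀P-unital , (λ { fzero → a₀∝v ; (fsuc t) → a∝v t }) ,
           λ l l∉f j → Ideal.*-≡1 l {a₀ j} {P j}
                         (a₀≡1 (isIdeal l) (e∈ i l λ l≡i → l∉f fzero (≡.sym l≡i)) j)
                         (P≡1 l (l∉f ∘ fsuc) j)

      completeRows : ∀ i₀ i₁ → i₁ ≢ i₀ → (P : Fin k → Carrier) → Unital R k P →
        (∀ j → I i₀ (P j - 1#)) → (∀ j → I i₁ (P j - 1#)) →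
        Σ (Fin k → Carrier) λ a₀ → Σ (Fin k → Carrier) λ a₁ →
          a₀ ∙ (a₁ ⊛ P) ≈ 1# × ProportionalMod (I i₀) a₀ (v i₀) × ProportionalMod (I i₁) a₁ (v i₁)
      completeRows i₀ i₁ i₁≢i₀ P (β , β∙P≈1) P≡1₀ P≡1₁ =
        let (a , (γ , γ∙aP≈1) , a∝v₁ , _) =
              extendRow P β (b i₁) (v i₁) (e i₁) (isIdeal i₁) (stableRangeOne i₁) β∙P≈1
                (b-unimodular i₁ P P≡1₁) (e≡1 i₁)
            (a₀ , a₁ , a₀∙a₁P≈1 , a₀∝v₀ , a₁≡a) =
              closeRows P a γ (e·b i₀) (v i₀) (isIdeal i₀) (isIdeal i₁) (stableRangeOne i₀) γ∙aP≈1
                (e·b-unimodular i₀ P P≡1₀) (λ j → Ideal.*∈ʳ i₁ (b i₀ j) (e∈ i₀ i₁ i₁≢i₀))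
        in a₀ , a₁ , a₀∙a₁P≈1 , a₀∝v₀ , ProportionalMod-resp-≡ a₁ a (v i₁) (isIdeal i₁) a₁≡a a∝v₁

mainTheorem14 : ∀ {c ℓ : Level} (R : CommutativeRing c ℓ) → IsDedekindType R →
    (r k : ℕ) → 2 ≤ r → 2 ≤ k →
    (I : Fin r → Subset R) → (∀ i → InMonoidM R (I i)) →
    (∀ i j → i ≢ j → Comaximal R (I i) (I j)) →
    (v : Fin r → Fin k → CommutativeRing.Carrier R) → (∀ i → Unital R k (v i)) →
    Σ (Fin r → Fin k → CommutativeRing.Carrier R) λ A →
    InMrk R r k A × (∀ i → PFEquiv R (I i) k (A i) (v i))
mainTheorem14 R _ (suc (suc r)) (suc k) (s≤s (s≤s _)) (s≤s _) I I∈M comaximal v v-unital =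
  let (a , P-unital , a∝v , P≡1) =
        buildRows (𝟙-unital R k) r (fsuc ∘ fsuc) (λ eq → suc-injective (suc-injective eq))
      (a₀ , a₁ , a₀∙a₁P≈1 , a₀∝v₀ , a₁∝v₁) =
        completeRows fzero (fsuc fzero) (λ ()) (columnProduct R a) P-unital
          (P≡1 fzero λ _ ()) (P≡1 (fsuc fzero) λ _ ())
      A = a₀ ∷ a₁ ∷ a
      A∝v : ∀ i → ProportionalMod R (I i) (A i) (v i)
      A∝v = λ { fzero → a₀∝v₀ ; (fsuc fzero) → a₁∝v₁ ; (fsuc (fsuc t)) → a∝v t }
  in A , a₀∙a₁P≈1 , λ i → ProportionalMod⇒PFEquiv R (A i) (v i) (isIdeal i) (A∝v i)
  where
  isIdeal : ∀ i → IsIdeal R (I i)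
  isIdeal i = InMonoidM⇒isIdeal R (I∈M i)
  open RowConstruction R isIdeal (λ i → InMonoidM⇒stableRangeOne R (I∈M i)) comaximal v v-unital
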